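{- Let $\mathbb{F}_q$ be a finite field with $q\equiv 1\pmod{9}$, let $s=(q-1)/3$, let $\mu_3=\{u\in\mathbb{F}_q^*: u^3=1\}$, let $k$ be a positive integer and $r=1+ks$. Let $c\colon\mu_3\to\mathbb{F}_q^*$ be a function with $c(u)^s=1$ for all $u\in\mu_3$. Define $f\colon\mathbb{F}_q\to\mathbb{F}_q$ by $f(0)=0$ and $f(x)=x^r\,c(x^s)$ for $x\in\mathbb{F}_q^*$, and let $F(x)=f(x)+x$. For each $u\in\mu_3$ set $\tau(u)=1+c(u)\,u^k$ and $v(u)=\tau(u)^s$. Assume: (H1) $\tau(u)\neq 0$ for all $u\in\mu_3$; (H2) the map $\bar\psi\colon\mu_3\to\mu_3$, $\bar\psi(u)=u\cdot v(u)$, is a permutation of $\mu_3$. Then $f$ is a complete permutation polynomial of $\mathbb{F}_q$, i.e., both $f$ and $F$ are bijections of $\mathbb{F}_q$.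
   Context: A complete permutation polynomial of $\mathbb{F}_q$ is a polynomial (equivalently, a function $\mathbb{F}_q\to\mathbb{F}_q$) $f$ such that both $x\mapsto f(x)$ and $x\mapsto f(x)+x$ are permutations of $\mathbb{F}_q$. For $x\in\mathbb{F}_q^*$ one has $x^s\in\mu_3$, so $c(x^s)$ is defined; $f$ agrees on $\mathbb{F}_q$ with a polynomial $X^r h(X^s)$ where $h$ interpolates $c$ on $\mu_3$. -}

module Defs where

open import Level using (0ℓ)
open import Data.Nat as ℕ using (ℕ; zero; suc)
open import Data.Fin using (Fin)
open import Data.Product using (Σ; ∃; _×_; _,_)
open import Relation.Binary.PropositionalEquality using (_≡_)
open import Relation.Nullary using (¬_)
open import Algebra.Structures using (IsCommutativeRing)
open import Function.Bundles using (_↔_)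

record FiniteField : Set₁ where
  infixl 7 _*_
  infixl 6 _+_
  field
    Carrier : Set
    _+_ _*_ : Carrier → Carrier → Carrier
    -_      : Carrier → Carrier
    0# 1#   : Carrier
    isCommutativeRing : IsCommutativeRing _≡_ _+_ _*_ -_ 0# 1#
    0≢1     : ¬ (0# ≡ 1#)
    inverse : ∀ x → ¬ (x ≡ 0#) → ∃ λ y → x * y ≡ 1#
    order   : ℕ
    enum    : Carrier ↔ Fin order

  infixr 8 _^_
  _^_ : Carrier → ℕ → Carrier
  x ^ zero  = 1#
  x ^ suc n = x * (x ^ n)

  μ₃ : Carrier → Set
  μ₃ u = u ^ 3 ≡ 1#

  PermutesOn : (Carrier → Set) → (Carrier → Carrier) → Set
  PermutesOn P g =
    (∀ u → P u → P (g u))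
    × (∀ u w → P u → P w → g u ≡ g w → u ≡ w)
    × (∀ w → P w → Σ Carrier λ u → P u × g u ≡ w)

-- For x ≠ 0 put u = x^s, which lies in μ₃ because x^(q−1) = 1. On 𝔽* both maps have
-- the shape x ↦ x·M(x^s): M(u) = c(u)·u^k for f, and M = τ for F = f + id. Such a map
-- is injective once u ↦ u·M(u)^s is injective on μ₃: equal values have equal s-th
-- powers u·M(u)^s, hence the same u, and M(u) ≠ 0 cancels. For f that map is the
-- identity, since 9 ∣ q − 1 makes u^s = 1 on μ₃ and c(u)^s = 1; for F it is ψ̄.
-- An injective self-map of a finite set is a bijection.
module Submission where

open import Defs
open import Data.Nat as ℕ using (ℕ; _∸_; _%_; NonZero)
open import Data.Nat.DivMod using (_/_)
open import Data.Product using (_×_)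
open import Relation.Binary.PropositionalEquality using (_≡_)
open import Relation.Nullary using (¬_)
open import Function.Definitions using (Bijective)

open import Data.Nat using (zero; suc)
import Data.Nat.Properties as ℕₚ
open import Data.Nat.DivMod using (m≡m%n+[m/n]*n; m/n*n≡m)
open import Data.Nat.Divisibility using (_∣_; divides; ∣-trans; m*n∣o⇒m∣o/n)
open import Data.Fin using (Fin; punchOut; punchIn)
import Data.Fin.Properties as Finₚ
open import Data.Fin.Permutation using (Permutation)
open import Data.Vec.Functional using (Vector; removeAt; replicate)
open import Data.Product using (_,_; proj₁; proj₂)
open import Data.Empty using (⊥-elim)
open import Function.Base using (_∘_)
open import Function.Bundles using (Inverse; _↔_; mk⤖)
open import Function.Definitions using (Injective; StrictlySurjective)
open import Function.Consequences.Propositional using (strictlySurjective⇒surjective)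
open import Function.Properties.Bijection using (⤖⇒↔)
open import Function.Properties.Inverse using (↔-sym; ↔-trans; ↔⇒↣)
open import Relation.Nullary using (Dec; yes; no; contradiction)
open import Relation.Nullary.Decidable using (via-injection)
open import Relation.Binary.PropositionalEquality
  using (_≢_; refl; sym; trans; cong; cong₂; module ≡-Reasoning)
open import Algebra.Bundles using (CommutativeRing)
import Algebra.Properties.CommutativeSemiring.Exp as Exp
import Algebra.Properties.CommutativeMonoid.Sum as Sum
import Algebra.Properties.CommutativeSemigroup as CommutativeSemigroup

Fin-injective⇒surjective : ∀ {n} {f : Fin n → Fin n} →
  Injective _≡_ _≡_ f → StrictlySurjective _≡_ f
Fin-injective⇒surjective {suc n} {f} f-inj y with Finₚ.any? (λ x → f x Finₚ.≟ y)
... | yes hit  = hit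
... | no  miss = ⊥-elim (Finₚ.<⇒notInjective (ℕₚ.n<1+n n) punchOut∘f-injective)
  where
  fx≢y : ∀ x → y ≢ f x
  fx≢y x y≡fx = miss (x , sym y≡fx)
  punchOut∘f-injective : Injective _≡_ _≡_ (λ x → punchOut (fx≢y x))
  punchOut∘f-injective eq = f-inj (Finₚ.punchOut-injective (fx≢y _) (fx≢y _) eq)

injective⇒bijective : ∀ {A : Set} {n} → A ↔ Fin n → {f : A → A} →
  Injective _≡_ _≡_ f → Bijective _≡_ _≡_ f
injective⇒bijective enum {f} f-inj =
  f-inj , strictlySurjective⇒surjective f-surjective
  where
  open Inverse enum
  to-injective : Injective _≡_ _≡_ to
  to-injective {a} {b} eq = trans (sym (strictlyInverseʳ a)) (trans (cong from eq) (strictlyInverseʳ b))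
  from-injective : Injective _≡_ _≡_ from
  from-injective {i} {j} eq = trans (sym (strictlyInverseˡ i)) (trans (cong to eq) (strictlyInverseˡ j))
  f-surjective : StrictlySurjective _≡_ f
  f-surjective y with Fin-injective⇒surjective (from-injective ∘ f-inj ∘ to-injective) (to y)
  ... | i , fi≡y = from i , to-injective fi≡y

m%n≡1⇒n∣m∸1 : ∀ m n .{{_ : NonZero n}} → m % n ≡ 1 → n ∣ m ∸ 1
m%n≡1⇒n∣m∸1 m n m%n≡1 =
  divides (m / n) (cong (_∸ 1) (trans (m≡m%n+[m/n]*n m n) (cong (ℕ._+ m / n ℕ.* n) m%n≡1)))

module FiniteFieldTheory (𝔽 : FiniteField) where
  open FiniteField 𝔽

  ring : CommutativeRing _ _
  ring = record { isCommutativeRing = isCommutativeRing }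

  open CommutativeRing ring
    using (*-assoc; *-comm; *-identityˡ; *-identityʳ; +-comm; distribˡ; zeroˡ; zeroʳ;
           commutativeSemiring; *-commutativeMonoid; *-commutativeSemigroup)
  open Exp commutativeSemiring using ()
    renaming (_^_ to _^ᴿ_; ^-assocʳ to ^ᴿ-assocʳ; ^-distrib-* to ^ᴿ-distrib-*)
  open Sum *-commutativeMonoid using (sum-cong-≗; sum-remove; sum-replicate; ∑-distrib-+; sum-permute)
    renaming (sum to ∏)
  open CommutativeSemigroup *-commutativeSemigroup using (x∙yz≈y∙xz; xy∙z≈x∙zy)
  open Inverse enum using (to; from; strictlyInverseˡ; strictlyInverseʳ)
  open ≡-Reasoning

  _≟_ : (x y : Carrier) → Dec (x ≡ y)
  _≟_ = via-injection (↔⇒↣ enum) Finₚ._≟_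

  *-cancelˡ : ∀ {x a b} → x ≢ 0# → x * a ≡ x * b → a ≡ b
  *-cancelˡ {x} {a} {b} x≢0 xa≡xb = trans (sym (undo a)) (trans (cong (x⁻¹ *_) xa≡xb) (undo b))
    where
    x⁻¹ : Carrier
    x⁻¹ = proj₁ (inverse x x≢0)
    undo : ∀ c → x⁻¹ * (x * c) ≡ c
    undo c = begin
      x⁻¹ * (x * c)  ≡⟨ *-assoc x⁻¹ x c ⟨
      x⁻¹ * x * c    ≡⟨ cong (_* c) (trans (*-comm x⁻¹ x) (proj₂ (inverse x x≢0))) ⟩
      1# * c         ≡⟨ *-identityˡ c ⟩
      c              ∎

  *-cancelʳ : ∀ {x a b} → x ≢ 0# → a * x ≡ b * x → a ≡ b
  *-cancelʳ {x} {a} {b} x≢0 ax≡bx = *-cancelˡ x≢0 (trans (*-comm x a) (trans ax≡bx (*-comm b x)))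

  *-nonzero : ∀ {x y} → x ≢ 0# → y ≢ 0# → x * y ≢ 0#
  *-nonzero {x} x≢0 y≢0 xy≡0 = y≢0 (*-cancelˡ x≢0 (trans xy≡0 (sym (zeroʳ x))))

  ^-nonzero : ∀ {x} n → x ≢ 0# → x ^ n ≢ 0#
  ^-nonzero zero    x≢0 1≡0 = 0≢1 (sym 1≡0)
  ^-nonzero (suc n) x≢0     = *-nonzero x≢0 (^-nonzero n x≢0)

  ^≡^ᴿ : ∀ x n → x ^ n ≡ x ^ᴿ n
  ^≡^ᴿ x zero    = refl
  ^≡^ᴿ x (suc n) = cong (x *_) (^≡^ᴿ x n)

  ^-assocʳ : ∀ x m n → (x ^ m) ^ n ≡ x ^ (m ℕ.* n)
  ^-assocʳ x m n = begin
    (x ^ m) ^ n     ≡⟨ trans (^≡^ᴿ (x ^ m) n) (cong (_^ᴿ n) (^≡^ᴿ x m)) ⟩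
    (x ^ᴿ m) ^ᴿ n   ≡⟨ ^ᴿ-assocʳ x m n ⟩
    x ^ᴿ (m ℕ.* n)  ≡⟨ ^≡^ᴿ x (m ℕ.* n) ⟨
    x ^ (m ℕ.* n)   ∎

  ^-distrib-* : ∀ x y n → (x * y) ^ n ≡ x ^ n * y ^ n
  ^-distrib-* x y n = begin
    (x * y) ^ n        ≡⟨ ^≡^ᴿ (x * y) n ⟩
    (x * y) ^ᴿ n       ≡⟨ ^ᴿ-distrib-* x y n ⟩
    x ^ᴿ n * y ^ᴿ n    ≡⟨ cong₂ _*_ (^≡^ᴿ x n) (^≡^ᴿ y n) ⟨
    x ^ n * y ^ n      ∎

  1^n≡1 : ∀ n → 1# ^ n ≡ 1#
  1^n≡1 zero    = refl
  1^n≡1 (suc n) = trans (*-identityˡ _) (1^n≡1 n)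

  ∏-nonzero : ∀ {n} (a : Vector Carrier n) → (∀ i → a i ≢ 0#) → ∏ a ≢ 0#
  ∏-nonzero {zero}  a a≢0 1≡0 = 0≢1 (sym 1≡0)
  ∏-nonzero {suc n} a a≢0     = *-nonzero (a≢0 Fin.zero) (∏-nonzero (a ∘ Fin.suc) (a≢0 ∘ Fin.suc))

  ∏-swap-at : ∀ {n} (a b : Vector Carrier n) j → (∀ i → i ≢ j → a i ≡ b i) →
              a j * ∏ b ≡ b j * ∏ a
  ∏-swap-at {suc n} a b j a≡b-off-j = begin
    a j * ∏ b                      ≡⟨ cong (a j *_) (sum-remove {i = j} b) ⟩
    a j * (b j * ∏ (removeAt b j)) ≡⟨ x∙yz≈y∙xz (a j) (b j) _ ⟩
    b j * (a j * ∏ (removeAt b j)) ≡⟨ cong (λ r → b j * (a j * r)) (sum-cong-≗ removedAgree) ⟨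
    b j * (a j * ∏ (removeAt a j)) ≡⟨ cong (b j *_) (sum-remove {i = j} a) ⟨
    b j * ∏ a                      ∎
    where
    removedAgree : ∀ i → removeAt a j i ≡ removeAt b j i
    removedAgree i = a≡b-off-j (punchIn j i) (Finₚ.punchInᵢ≢i j i)

  zeroToOne : Carrier → Carrier
  zeroToOne y with y ≟ 0#
  ... | yes _ = 1#
  ... | no  _ = y

  zeroToOne-0 : zeroToOne 0# ≡ 1#
  zeroToOne-0 with 0# ≟ 0#
  ... | yes _   = refl
  ... | no  0≢0 = contradiction refl 0≢0

  zeroToOne-≢0 : ∀ {y} → y ≢ 0# → zeroToOne y ≡ y
  zeroToOne-≢0 {y} y≢0 with y ≟ 0#
  ... | yes y≡0 = contradiction y≡0 y≢0
  ... | no  _   = refl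

  zeroToOne≢0 : ∀ y → zeroToOne y ≢ 0#
  zeroToOne≢0 y with y ≟ 0#
  ... | yes _   = λ 1≡0 → 0≢1 (sym 1≡0)
  ... | no  y≢0 = y≢0

  *-permutation : ∀ {x} → x ≢ 0# → Permutation order order
  *-permutation x≢0 =
    ↔-trans (↔-sym enum) (↔-trans (⤖⇒↔ (mk⤖ (injective⇒bijective enum (*-cancelˡ x≢0)))) enum)

  -- Multiplication by x permutes 𝔽, so ∏ zeroToOne (x·y) = ∏ zeroToOne y; and termwise
  -- x · zeroToOne y = zeroToOne (x·y) except at y = 0, where the two factors are x and 1.
  x^order≡x : ∀ {x} → x ≢ 0# → x ^ order ≡ x
  x^order≡x {x} x≢0 = *-cancelʳ (∏-nonzero Z (zeroToOne≢0 ∘ from)) (begin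
    x ^ order * ∏ Z              ≡⟨ cong (_* ∏ Z) (trans (^≡^ᴿ x order) (sym (sum-replicate order))) ⟩
    ∏ (replicate order x) * ∏ Z  ≡⟨ ∑-distrib-+ (replicate order x) Z ⟨
    ∏ xZ                         ≡⟨ *-identityˡ (∏ xZ) ⟨
    1# * ∏ xZ                    ≡⟨ cong (_* ∏ xZ) Zx[j]≡1 ⟨
    Zx j * ∏ xZ                  ≡⟨ ∏-swap-at xZ Zx j xZ≡Zx-off-j ⟨
    xZ j * ∏ Zx                  ≡⟨ cong₂ _*_ xZ[j]≡x (sym ∏Z≡∏Zx) ⟩
    x * ∏ Z                      ∎)
    where
    Z xZ Zx : Vector Carrier order
    Z  i = zeroToOne (from i)
    xZ i = x * Z i
    Zx i = zeroToOne (x * from i)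
    j : Fin order
    j = to 0#
    from[j]≡0 : from j ≡ 0#
    from[j]≡0 = strictlyInverseʳ 0#
    Zx[j]≡1 : Zx j ≡ 1#
    Zx[j]≡1 = trans (cong (λ y → zeroToOne (x * y)) from[j]≡0)
                    (trans (cong zeroToOne (zeroʳ x)) zeroToOne-0)
    xZ[j]≡x : xZ j ≡ x
    xZ[j]≡x = trans (cong (λ y → x * zeroToOne y) from[j]≡0)
                    (trans (cong (x *_) zeroToOne-0) (*-identityʳ x))
    xZ≡Zx-off-j : ∀ i → i ≢ j → xZ i ≡ Zx i
    xZ≡Zx-off-j i i≢j =
      trans (cong (x *_) (zeroToOne-≢0 from[i]≢0)) (sym (zeroToOne-≢0 (*-nonzero x≢0 from[i]≢0)))
      where
      from[i]≢0 : from i ≢ 0#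
      from[i]≢0 from[i]≡0 = i≢j (trans (sym (strictlyInverseˡ i)) (cong to from[i]≡0))
    ∏Z≡∏Zx : ∏ Z ≡ ∏ Zx
    ∏Z≡∏Zx = trans (sum-permute Z (*-permutation x≢0))
                   (sum-cong-≗ (λ i → cong zeroToOne (strictlyInverseʳ (x * from i))))

  fermat : ∀ {x} → x ≢ 0# → x ^ (order ∸ 1) ≡ 1#
  fermat {x} x≢0 = *-cancelˡ x≢0 (begin
    x * x ^ (order ∸ 1)  ≡⟨ cong (x ^_) order≡1+[order∸1] ⟨
    x ^ order            ≡⟨ x^order≡x x≢0 ⟩
    x                    ≡⟨ *-identityʳ x ⟨
    x * 1#               ∎)
    where
    order≡1+[order∸1] : order ≡ suc (order ∸ 1)
    order≡1+[order∸1] = sym (ℕₚ.m+[n∸m]≡n (ℕ.>-nonZero⁻¹ order {{Finₚ.nonZeroIndex (to 0#)}}))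

  μ₃⇒≢0 : ∀ {u} → μ₃ u → u ≢ 0#
  μ₃⇒≢0 {u} u³≡1 u≡0 = 0≢1 (trans (sym (trans (cong (_^ 3) u≡0) (zeroˡ (0# ^ 2)))) u³≡1)

  ^-∈μ₃ : ∀ {s x} → s ℕ.* 3 ≡ order ∸ 1 → x ≢ 0# → μ₃ (x ^ s)
  ^-∈μ₃ {s} {x} s*3≡q∸1 x≢0 = begin
    (x ^ s) ^ 3     ≡⟨ ^-assocʳ x s 3 ⟩
    x ^ (s ℕ.* 3)   ≡⟨ cong (x ^_) s*3≡q∸1 ⟩
    x ^ (order ∸ 1) ≡⟨ fermat x≢0 ⟩
    1#              ∎

  μ₃⇒^≡1 : ∀ {s u} → 3 ∣ s → μ₃ u → u ^ s ≡ 1#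
  μ₃⇒^≡1 {u = u} (divides t refl) u³≡1 = begin
    u ^ (t ℕ.* 3)  ≡⟨ cong (u ^_) (ℕₚ.*-comm t 3) ⟩
    u ^ (3 ℕ.* t)  ≡⟨ ^-assocʳ u 3 t ⟨
    (u ^ 3) ^ t    ≡⟨ cong (_^ t) u³≡1 ⟩
    1# ^ t         ≡⟨ 1^n≡1 t ⟩
    1#             ∎

  module _ (P : Carrier → Set) (s : ℕ) (M : Carrier → Carrier)
           (xˢ∈P : ∀ {x} → x ≢ 0# → P (x ^ s))
           (M≢0 : ∀ {u} → P u → M u ≢ 0#)
           (u*Mᵘˢ-injective : ∀ {u w} → P u → P w → u * M u ^ s ≡ w * M w ^ s → u ≡ w)
    where

    x*M[xˢ]≢0 : ∀ {x} → x ≢ 0# → x * M (x ^ s) ≢ 0#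
    x*M[xˢ]≢0 x≢0 = *-nonzero x≢0 (M≢0 (xˢ∈P x≢0))

    x*M[xˢ]-injective : ∀ {x y} → x ≢ 0# → y ≢ 0# → x * M (x ^ s) ≡ y * M (y ^ s) → x ≡ y
    x*M[xˢ]-injective {x} {y} x≢0 y≢0 eq = *-cancelʳ (M≢0 (xˢ∈P y≢0)) (begin
      x * M (y ^ s)  ≡⟨ cong (λ u → x * M u) xˢ≡yˢ ⟨
      x * M (x ^ s)  ≡⟨ eq ⟩
      y * M (y ^ s)  ∎)
      where
      xˢ≡yˢ : x ^ s ≡ y ^ s
      xˢ≡yˢ = u*Mᵘˢ-injective (xˢ∈P x≢0) (xˢ∈P y≢0) (begin
        x ^ s * M (x ^ s) ^ s  ≡⟨ ^-distrib-* x _ s ⟨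
        (x * M (x ^ s)) ^ s    ≡⟨ cong (_^ s) eq ⟩
        (y * M (y ^ s)) ^ s    ≡⟨ ^-distrib-* y _ s ⟩
        y ^ s * M (y ^ s) ^ s  ∎)

    zero-extension-injective : ∀ {g : Carrier → Carrier} → g 0# ≡ 0# →
      (∀ {x} → x ≢ 0# → g x ≡ x * M (x ^ s)) → Injective _≡_ _≡_ g
    zero-extension-injective {g} g0≡0 g≡ {x} {y} gx≡gy with x ≟ 0# | y ≟ 0#
    ... | yes x≡0 | yes y≡0 = trans x≡0 (sym y≡0)
    ... | yes x≡0 | no  y≢0 = contradiction
      (trans (sym (g≡ y≢0)) (trans (sym gx≡gy) (trans (cong g x≡0) g0≡0))) (x*M[xˢ]≢0 y≢0)
    ... | no  x≢0 | yes y≡0 = contradiction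
      (trans (sym (g≡ x≢0)) (trans gx≡gy (trans (cong g y≡0) g0≡0))) (x*M[xˢ]≢0 x≢0)
    ... | no  x≢0 | no  y≢0 =
      x*M[xˢ]-injective x≢0 y≢0 (trans (sym (g≡ x≢0)) (trans gx≡gy (g≡ y≢0)))

  x^[1+ks]*a≡x*[a*[xˢ]ᵏ] : ∀ x k s a → x ^ (1 ℕ.+ k ℕ.* s) * a ≡ x * (a * (x ^ s) ^ k)
  x^[1+ks]*a≡x*[a*[xˢ]ᵏ] x k s a = begin
    x * x ^ (k ℕ.* s) * a    ≡⟨ xy∙z≈x∙zy x _ a ⟩
    x * (a * x ^ (k ℕ.* s))  ≡⟨ cong (λ e → x * (a * x ^ e)) (ℕₚ.*-comm k s) ⟩
    x * (a * x ^ (s ℕ.* k))  ≡⟨ cong (λ p → x * (a * p)) (^-assocʳ x s k) ⟨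
    x * (a * (x ^ s) ^ k)    ∎

  x*a+x≡x*[1+a] : ∀ x a → x * a + x ≡ x * (1# + a)
  x*a+x≡x*[1+a] x a = begin
    x * a + x        ≡⟨ cong (x * a +_) (*-identityʳ x) ⟨
    x * a + x * 1#   ≡⟨ distribˡ x a 1# ⟨
    x * (a + 1#)     ≡⟨ cong (x *_) (+-comm a 1#) ⟩
    x * (1# + a)     ∎

  [c*uᵏ]ˢ≡1 : ∀ {c u} k s → c ^ s ≡ 1# → u ^ s ≡ 1# → (c * u ^ k) ^ s ≡ 1#
  [c*uᵏ]ˢ≡1 {c} {u} k s cˢ≡1 uˢ≡1 = begin
    (c * u ^ k) ^ s     ≡⟨ ^-distrib-* c (u ^ k) s ⟩
    c ^ s * (u ^ k) ^ s ≡⟨ cong₂ _*_ cˢ≡1 (^-assocʳ u k s) ⟩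
    1# * u ^ (k ℕ.* s)  ≡⟨ *-identityˡ _ ⟩
    u ^ (k ℕ.* s)       ≡⟨ cong (u ^_) (ℕₚ.*-comm k s) ⟩
    u ^ (s ℕ.* k)       ≡⟨ ^-assocʳ u s k ⟨
    (u ^ s) ^ k         ≡⟨ cong (_^ k) uˢ≡1 ⟩
    1# ^ k              ≡⟨ 1^n≡1 k ⟩
    1#                  ∎

theorem5p1 : (𝔽 : FiniteField) → let open FiniteField 𝔽 in
    order % 9 ≡ 1 →
    (k : ℕ) → NonZero k →
    (c : Carrier → Carrier) →
    (∀ u → μ₃ u → ¬ (c u ≡ 0#)) →
    (∀ u → μ₃ u → c u ^ ((order ∸ 1) / 3) ≡ 1#) →
    (f : Carrier → Carrier) →
    f 0# ≡ 0# →
    (∀ x → ¬ (x ≡ 0#) →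
      f x ≡ x ^ (1 ℕ.+ k ℕ.* ((order ∸ 1) / 3)) * c (x ^ ((order ∸ 1) / 3))) →
    (∀ u → μ₃ u → ¬ (1# + c u * u ^ k ≡ 0#)) →
    PermutesOn μ₃ (λ u → u * (1# + c u * u ^ k) ^ ((order ∸ 1) / 3)) →
    Bijective _≡_ _≡_ f × Bijective _≡_ _≡_ (λ x → f x + x)
theorem5p1 𝔽 q%9≡1 k _ c c≢0 cˢ≡1 f f0≡0 f≡ τ≢0 ψ̄-permutes =
  injective⇒bijective enum f-injective , injective⇒bijective enum F-injective
  where
  open FiniteField 𝔽
  open FiniteFieldTheory 𝔽
  open CommutativeRing ring using (*-identityʳ; +-identityʳ)
  s : ℕ
  s = (order ∸ 1) / 3
  9∣q∸1 : 9 ∣ order ∸ 1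
  9∣q∸1 = m%n≡1⇒n∣m∸1 order 9 q%9≡1
  xˢ∈μ₃ : ∀ {x} → x ≢ 0# → μ₃ (x ^ s)
  xˢ∈μ₃ = ^-∈μ₃ {s} (m/n*n≡m {n = 3} (∣-trans (divides 3 refl) 9∣q∸1))
  L : Carrier → Carrier
  L u = c u * u ^ k
  u*Lᵘˢ≡u : ∀ {u} → μ₃ u → u * L u ^ s ≡ u
  u*Lᵘˢ≡u {u} u∈μ₃ = trans (cong (u *_) Lᵘˢ≡1) (*-identityʳ u)
    where
    Lᵘˢ≡1 : L u ^ s ≡ 1#
    Lᵘˢ≡1 = [c*uᵏ]ˢ≡1 k s (cˢ≡1 u u∈μ₃) (μ₃⇒^≡1 (m*n∣o⇒m∣o/n 3 3 9∣q∸1) u∈μ₃)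
  f≡x*L[xˢ] : ∀ {x} → x ≢ 0# → f x ≡ x * L (x ^ s)
  f≡x*L[xˢ] {x} x≢0 = trans (f≡ x x≢0) (x^[1+ks]*a≡x*[a*[xˢ]ᵏ] x k s _)
  f-injective : Injective _≡_ _≡_ f
  f-injective = zero-extension-injective μ₃ s L xˢ∈μ₃
    (λ u∈μ₃ → *-nonzero (c≢0 _ u∈μ₃) (^-nonzero k (μ₃⇒≢0 u∈μ₃)))
    (λ u∈μ₃ w∈μ₃ eq → trans (sym (u*Lᵘˢ≡u u∈μ₃)) (trans eq (u*Lᵘˢ≡u w∈μ₃)))
    f0≡0 f≡x*L[xˢ]
  F-injective : Injective _≡_ _≡_ (λ x → f x + x)
  F-injective = zero-extension-injective μ₃ s (λ u → 1# + L u) xˢ∈μ₃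
    (τ≢0 _)
    (proj₁ (proj₂ ψ̄-permutes) _ _)
    (trans (+-identityʳ _) f0≡0)
    (λ {x} x≢0 → trans (cong (_+ x) (f≡x*L[xˢ] x≢0)) (x*a+x≡x*[1+a] x _))
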